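{- Let $q$ be a prime power and $n \ge 3$ an integer. Then $\mathcal{A}_q(n,n-1,n-2;q) \ge q^{n-1}$.
   Context: A $t$-$(n,k,\lambda)_q$ subspace packing is a collection of $k$-dimensional subspaces (blocks) of $\mathbb{F}_q^n$ such that every $t$-dimensional subspace of $\mathbb{F}_q^n$ is contained in at most $\lambda$ blocks. $\mathcal{A}_q(n,k,t;\lambda)$ denotes the maximum number of blocks of such a packing without repeated blocks (i.e., the blocks form a set). -}

module Defs where

open import Level using (Level; _⊔_)
open import Data.Nat using (ℕ; zero; suc)
open import Data.Fin using (Fin; zero; suc)
open import Data.Product using (∃; Σ; _×_)
open import Relation.Nullary using (¬_)
open import Relation.Binary.Definitions using (Decidable)
open import Relation.Binary.PropositionalEquality using (_≡_)
open import Algebra.Bundles using (CommutativeRing)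

-- Equality is assumed decidable (true of every finite field).
record FiniteField (q : ℕ) (c ℓ : Level) : Set (Level.suc (c ⊔ ℓ)) where
  field
    ring : CommutativeRing c ℓ
  open CommutativeRing ring hiding (zero)
  field
    0≉1      : ¬ (0# ≈ 1#)
    inverse  : ∀ x → ¬ (x ≈ 0#) → ∃ λ y → (x * y) ≈ 1#
    _≟_      : Decidable _≈_
    enum     : Fin q → Carrier
    enum-inj : ∀ i j → enum i ≈ enum j → i ≡ j
    enum-sur : ∀ x → ∃ λ i → enum i ≈ x

module LinAlg {c ℓ : Level} (R : CommutativeRing c ℓ) where
  open CommutativeRing R hiding (zero)

  Vect : ℕ → Set c
  Vect n = Fin n → Carrier

  sumF : (k : ℕ) → (Fin k → Carrier) → Carrier
  sumF zero    f = 0#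
  sumF (suc k) f = f zero + sumF k (λ i → f (suc i))

  lincomb : ∀ {k n} → (Fin k → Vect n) → (Fin k → Carrier) → Vect n
  lincomb {k} B co j = sumF k (λ i → co i * B i j)

  _∈span_ : ∀ {k n} → Vect n → (Fin k → Vect n) → Set (c ⊔ ℓ)
  _∈span_ {k} {n} v B = ∃ λ (co : Fin k → Carrier) → ∀ j → v j ≈ lincomb B co j

  LinIndep : ∀ {k n} → (Fin k → Vect n) → Set (c ⊔ ℓ)
  LinIndep {k} {n} B =
    ∀ (co : Fin k → Carrier) → (∀ j → lincomb B co j ≈ 0#) → ∀ i → co i ≈ 0#

  _⊆span_ : ∀ {a b n} → (Fin a → Vect n) → (Fin b → Vect n) → Set (c ⊔ ℓ)
  _⊆span_ {n = n} A B = ∀ (v : Vect n) → v ∈span A → v ∈span B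

  SameSpan : ∀ {a b n} → (Fin a → Vect n) → (Fin b → Vect n) → Set (c ⊔ ℓ)
  SameSpan A B = (A ⊆span B) × (B ⊆span A)

  -- A t-(n,k,λ) subspace packing without repeated blocks, with m blocks.
  -- Block i is the k-dimensional subspace spanned by the k linearly
  -- independent rows of  blocks i.
  record IsPacking (n k t lam m : ℕ) (blocks : Fin m → Fin k → Vect n)
         : Set (c ⊔ ℓ) where
    field
      indep    : ∀ i → LinIndep (blocks i)
      distinct : ∀ i j → SameSpan (blocks i) (blocks j) → i ≡ j
      packing  : ∀ (T : Fin t → Vect n) → LinIndep T →
                 ∀ (g : Fin (suc lam) → Fin m) → (∀ a b → g a ≡ g b → a ≡ b) →
                 ¬ (∀ a → T ⊆span blocks (g a))

module Submission where

-- Write n = k + 1 with k = p + 2.  For every a ∈ F^k take the hyperplane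
-- H_a = {x : x_0 = Σ_l a_l x_{l+1}}, spanned by the rows e_{l+1} + a_l e_0.
-- These q^k hyperplanes are pairwise distinct, and an (n-2)-space T lies in
-- at most q of them: given q+1 of them containing T, pick a coordinate j at
-- which two of the forms differ; by pigeonhole two others agree at j and so
-- differ at some i ≠ j.  Since dim T = p + 1 exceeds the p linear conditions
-- "x_{l+1} = 0 for l ∉ {i, j}", some nonzero x ∈ T satisfies them; the pair
-- agreeing at j forces x_{i+1} = 0, the pair differing at j then x_{j+1} = 0,
-- and finally x_0 = 0, so x = 0 — a contradiction.

open import Defs
open import Level using (Level)
open import Data.Nat using (ℕ; _≤_; _∸_; _^_)
open import Data.Fin using (Fin)
open import Data.Product using (∃; Σ; _×_)

open import Level using (_⊔_)
open import Data.Nat using (zero; suc; s≤s)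
open import Data.Nat.Properties using (≤-refl; n<1+n)
open import Data.Fin using (zero; suc; punchIn; punchOut; finToFun; funToFin; combine)
open import Data.Fin.Properties
  using (0≢1+n; punchInᵢ≢i; punchIn-punchOut; ¬∀⟶∃¬; all?; pigeonhole; <⇒≢; funToFin-finToFin)
  renaming (_≟_ to _≟ᶠ_)
open import Data.Vec.Functional using (insertAt)
open import Data.Vec.Functional.Properties using (insertAt-lookup; insertAt-punchIn)
open import Data.Product using (_,_; proj₁; proj₂)
open import Data.Empty using (⊥; ⊥-elim)
open import Function using (_∘_)
open import Relation.Nullary using (¬_; yes; no)
open import Relation.Binary.PropositionalEquality as ≡ using (_≡_; _≢_; _≗_)
open import Algebra.Bundles using (CommutativeRing)
import Algebra.Properties.Ring as RingProperties
import Algebra.Properties.Semiring.Sum as SumProperties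
import Relation.Binary.Reasoning.Setoid as SetoidReasoning

module Sums {c ℓ : Level} (R : CommutativeRing c ℓ) where
  open CommutativeRing R hiding (zero)
  open LinAlg R
  open SumProperties semiring public
    using (sum; sum-cong-≋; sum-remove; sum-replicate-zero; ∑-distrib-+; *-distribʳ-sum)

  sumF≡sum : ∀ k (f : Fin k → Carrier) → sumF k f ≡ sum f
  sumF≡sum zero    f = ≡.refl
  sumF≡sum (suc k) f = ≡.cong (f zero +_) (sumF≡sum k (f ∘ suc))

  lincomb≡sum : ∀ {k n} (B : Fin k → Vect n) co j → lincomb B co j ≡ sum (λ i → co i * B i j)
  lincomb≡sum {k} B co j = sumF≡sum k (λ i → co i * B i j)

  sum-zero : ∀ {k} (f : Fin k → Carrier) → (∀ i → f i ≈ 0#) → sum f ≈ 0#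
  sum-zero {k} f f≈0 = trans (sum-cong-≋ f≈0) (sum-replicate-zero k)

  sum-single : ∀ {k} (f : Fin k → Carrier) i → (∀ l → l ≢ i → f l ≈ 0#) → sum f ≈ f i
  sum-single {suc _} f i off = trans (sum-remove {i = i} f)
    (trans (+-congˡ (sum-zero _ (λ r → off (punchIn i r) (punchInᵢ≢i i r)))) (+-identityʳ (f i)))

module Hyperplanes {c ℓ : Level} (R : CommutativeRing c ℓ) {k : ℕ} where
  open CommutativeRing R hiding (zero)
  open LinAlg R
  open Sums R
  open SetoidReasoning setoid

  δ : Fin k → Fin k → Carrier
  δ i j with i ≟ᶠ j
  ... | yes _ = 1#
  ... | no  _ = 0#

  δ-diag : ∀ i → δ i i ≈ 1#
  δ-diag i with i ≟ᶠ i
  ... | yes _   = refl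
  ... | no  i≢i = ⊥-elim (i≢i ≡.refl)

  δ-off : ∀ {i j} → i ≢ j → δ i j ≈ 0#
  δ-off {i} {j} i≢j with i ≟ᶠ j
  ... | yes i≡j = ⊥-elim (i≢j i≡j)
  ... | no  _   = refl

  sum-δˡ : ∀ (y : Fin k → Carrier) j → sum (λ l → y l * δ l j) ≈ y j
  sum-δˡ y j = trans (sum-single (λ l → y l * δ l j) j (λ l l≢j → trans (*-congˡ (δ-off l≢j)) (zeroʳ (y l))))
                     (trans (*-congˡ (δ-diag j)) (*-identityʳ (y j)))

  sum-δʳ : ∀ i (y : Fin k → Carrier) → sum (λ l → δ i l * y l) ≈ y i
  sum-δʳ i y = trans (sum-single (λ l → δ i l * y l) i (λ l l≢i → trans (*-congʳ (δ-off (l≢i ∘ ≡.sym))) (zeroˡ (y l))))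
                     (trans (*-congʳ (δ-diag i)) (*-identityˡ (y i)))

  -- Row i of  hyperplane a  is e_{i+1} + a_i e_0; these k independent rows
  -- span the hyperplane {x ∈ R^{k+1} : x_0 = Σ_l a_l x_{l+1}}.
  hyperplane : (Fin k → Carrier) → Fin k → Vect (suc k)
  hyperplane a i zero    = a i
  hyperplane a i (suc j) = δ i j

  form : (Fin k → Carrier) → Vect (suc k) → Carrier
  form a x = sum (λ l → x (suc l) * a l)

  lincomb-tail : ∀ a co j → lincomb (hyperplane a) co (suc j) ≈ co j
  lincomb-tail a co j = trans (reflexive (lincomb≡sum (hyperplane a) co (suc j))) (sum-δˡ co j)

  ∈hyperplane : ∀ a v → v ∈span hyperplane a → v zero ≈ form a v
  ∈hyperplane a v (co , v≈) = begin
    v zero                          ≈⟨ v≈ zero ⟩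
    lincomb (hyperplane a) co zero  ≡⟨ lincomb≡sum (hyperplane a) co zero ⟩
    sum (λ l → co l * a l)          ≈⟨ sum-cong-≋ (λ l → *-congʳ (sym (trans (v≈ (suc l)) (lincomb-tail a co l)))) ⟩
    form a v                        ∎

  hyperplane-indep : ∀ a → LinIndep (hyperplane a)
  hyperplane-indep a co comb≈0 i = trans (sym (lincomb-tail a co i)) (comb≈0 (suc i))

  row∈hyperplane : ∀ a i → hyperplane a i ∈span hyperplane a
  row∈hyperplane a i = δ i , λ j →
    sym (trans (reflexive (lincomb≡sum (hyperplane a) (δ i) j)) (sum-δʳ i (λ l → hyperplane a l j)))

  -- Distinct forms give distinct hyperplanes: evaluate the form of b on the rows of a.
  hyperplane-injective : ∀ a b → hyperplane a ⊆span hyperplane b → ∀ i → a i ≈ b i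
  hyperplane-injective a b a⊆b i =
    trans (∈hyperplane b (hyperplane a i) (a⊆b _ (row∈hyperplane a i))) (sum-δʳ i b)

-- Linear dependence over a field; only the field axioms and decidability
-- of equality are used.
module Elimination {q : ℕ} {c ℓ : Level} (F : FiniteField q c ℓ) where
  open FiniteField F renaming (_≟_ to _≈?_; ring to R)
  open CommutativeRing R hiding (zero)
  open RingProperties ring using (-‿distribˡ-*; //-rightDividesˡ) renaming (x≈y⇒x∙y⁻¹≈ε to x≈y⇒x-y≈0)
  open LinAlg R
  open Sums R
  open SetoidReasoning setoid

  Dependent : ∀ {k n} → (Fin k → Vect n) → Set (c ⊔ ℓ)
  Dependent {k} {n} v =
    Σ (Fin k → Carrier) λ co → (∃ λ r → ¬ (co r ≈ 0#)) × (∀ m → lincomb v co m ≈ 0#)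

  reduce : ∀ {N} (v : Fin (suc (suc N)) → Vect (suc N)) → Fin (suc (suc N)) →
           (Fin (suc N) → Carrier) → Fin (suc N) → Vect N
  reduce v r₀ β r m = v (punchIn r₀ r) (suc m) - β r * v r₀ (suc m)

  -- If at coordinate 0 every row other
  -- than r₀ is β r times row r₀, then a dependence among the reduced rows
  -- v_r - β_r v_{r₀}, restricted to the remaining coordinates, lifts to v:
  -- the coefficient of row r₀ is  - Σ_r c'_r β_r.
  eliminate : ∀ {N} (v : Fin (suc (suc N)) → Vect (suc N)) r₀ (β : Fin (suc N) → Carrier) →
              (∀ r → v (punchIn r₀ r) zero ≈ β r * v r₀ zero) →
              Dependent (reduce v r₀ β) →
              Dependent v
  eliminate {N} v r₀ β pivot (c' , (r , c'r≉0) , c'-rel) = co , (punchIn r₀ r , co-nonzero) , co-rel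
    where
      reduced : Fin (suc N) → Vect (suc N)
      reduced r m = v (punchIn r₀ r) m - β r * v r₀ m

      s : Carrier
      s = sum (λ r → c' r * β r)

      co : Fin (suc (suc N)) → Carrier
      co = insertAt c' r₀ (- s)

      co-nonzero : ¬ (co (punchIn r₀ r) ≈ 0#)
      co-nonzero = c'r≉0 ∘ trans (reflexive (≡.sym (insertAt-punchIn c' r₀ (- s) r)))

      reduced-rel : ∀ m → sum (λ r → c' r * reduced r m) ≈ 0#
      reduced-rel zero    = sum-zero _ λ r →
        trans (*-congˡ (x≈y⇒x-y≈0 (pivot r))) (zeroʳ (c' r))
      reduced-rel (suc m) = trans (reflexive (≡.sym (lincomb≡sum (reduce v r₀ β) c' m))) (c'-rel m)

      split : ∀ m r → c' r * v (punchIn r₀ r) m ≈ c' r * reduced r m + (c' r * β r) * v r₀ m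
      split m r = begin
        c' r * v (punchIn r₀ r) m                        ≈⟨ *-congˡ (//-rightDividesˡ (β r * v r₀ m) (v (punchIn r₀ r) m)) ⟨
        c' r * (reduced r m + β r * v r₀ m)              ≈⟨ distribˡ (c' r) _ _ ⟩
        c' r * reduced r m + c' r * (β r * v r₀ m)       ≈⟨ +-congˡ (*-assoc (c' r) (β r) _) ⟨
        c' r * reduced r m + (c' r * β r) * v r₀ m       ∎

      co-rel : ∀ m → lincomb v co m ≈ 0#
      co-rel m = begin
        lincomb v co m
          ≡⟨ lincomb≡sum v co m ⟩
        sum (λ l → co l * v l m)
          ≈⟨ sum-remove {i = r₀} (λ l → co l * v l m) ⟩
        co r₀ * v r₀ m + sum (λ r → co (punchIn r₀ r) * v (punchIn r₀ r) m)
          ≈⟨ +-cong (*-congʳ (reflexive (insertAt-lookup c' r₀ (- s))))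
                    (sum-cong-≋ λ r → *-congʳ {v (punchIn r₀ r) m} (reflexive (insertAt-punchIn c' r₀ (- s) r))) ⟩
        - s * v r₀ m + sum (λ r → c' r * v (punchIn r₀ r) m)
          ≈⟨ +-congˡ (sum-cong-≋ (split m)) ⟩
        - s * v r₀ m + sum (λ r → c' r * reduced r m + (c' r * β r) * v r₀ m)
          ≈⟨ +-congˡ (∑-distrib-+ (λ r → c' r * reduced r m) (λ r → (c' r * β r) * v r₀ m)) ⟩
        - s * v r₀ m + (sum (λ r → c' r * reduced r m) + sum (λ r → (c' r * β r) * v r₀ m))
          ≈⟨ +-congˡ (+-cong (reduced-rel m) (sym (*-distribʳ-sum (v r₀ m) (λ r → c' r * β r)))) ⟩
        - s * v r₀ m + (0# + s * v r₀ m)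
          ≈⟨ +-cong (sym (-‿distribˡ-* s (v r₀ m))) (+-identityˡ _) ⟩
        - (s * v r₀ m) + s * v r₀ m
          ≈⟨ -‿inverseˡ _ ⟩
        0# ∎

  -- Eliminate coordinate 0:
  -- with a nonzero pivot r₀ use β_r = v_r(0) v_{r₀}(0)⁻¹, and if all first
  -- coordinates vanish already, take any r₀ and β = 0.
  dependence : ∀ N (v : Fin (suc N) → Vect N) → Dependent v
  dependence zero    v = (λ _ → 1#) , (zero , λ 1≈0 → 0≉1 (sym 1≈0)) , λ ()
  dependence (suc N) v with all? (λ r → v r zero ≈? 0#)
  ... | yes heads≈0 =
    eliminate v zero (λ _ → 0#) (λ r → trans (heads≈0 (suc r)) (sym (zeroˡ _)))
      (dependence N (reduce v zero (λ _ → 0#)))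
  ... | no ¬heads≈0 with ¬∀⟶∃¬ _ (λ r → v r zero ≈ 0#) (λ r → v r zero ≈? 0#) ¬heads≈0
  ...   | r₀ , pivot≉0 with inverse (v r₀ zero) pivot≉0
  ...     | y , pivot*y≈1 =
    eliminate v r₀ β (λ r → rescale (v (punchIn r₀ r) zero)) (dependence N (reduce v r₀ β))
    where
      β : Fin (suc N) → Carrier
      β r = v (punchIn r₀ r) zero * y

      rescale : ∀ a → a ≈ (a * y) * v r₀ zero
      rescale a = sym (begin
        (a * y) * v r₀ zero  ≈⟨ *-assoc a y _ ⟩
        a * (y * v r₀ zero)  ≈⟨ *-congˡ (trans (*-comm y _) pivot*y≈1) ⟩
        a * 1#               ≈⟨ *-identityʳ a ⟩
        a                    ∎)

module Separation {q : ℕ} {c ℓ : Level} (F : FiniteField q c ℓ) {k : ℕ} where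
  open FiniteField F renaming (ring to R)
  open CommutativeRing R hiding (zero)
  open RingProperties ring using (-‿distribʳ-*; x∙y⁻¹≈ε⇒x≈y; x≈y⇒x∙y⁻¹≈ε; +-cancelʳ)
  open LinAlg R
  open Sums R
  open Hyperplanes R {suc k}
  open SetoidReasoning setoid

  *-cancel-≉ : ∀ x a b → ¬ (a ≈ b) → x * a ≈ x * b → x ≈ 0#
  *-cancel-≉ x a b a≉b xa≈xb with inverse (a - b) (a≉b ∘ x∙y⁻¹≈ε⇒x≈y a b)
  ... | y , [a-b]y≈1 = begin
    x                  ≈⟨ *-identityʳ x ⟨
    x * 1#             ≈⟨ *-congˡ [a-b]y≈1 ⟨
    x * ((a - b) * y)  ≈⟨ *-assoc x (a - b) y ⟨
    (x * (a - b)) * y  ≈⟨ *-congʳ (distribˡ x a (- b)) ⟩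
    (x * a + x * - b) * y  ≈⟨ *-congʳ (+-congˡ (-‿distribʳ-* x b)) ⟨
    (x * a - x * b) * y    ≈⟨ *-congʳ (x≈y⇒x∙y⁻¹≈ε xa≈xb) ⟩
    0# * y             ≈⟨ zeroˡ y ⟩
    0#                 ∎

  -- Two hyperplanes through x whose forms differ at coordinate t, while the
  -- other terms x_{l+1} a_l and x_{l+1} b_l of the two forms agree: then
  -- x_{t+1} = 0, since both forms take the same value x_0 at x.
  separate : ∀ a b t x → x ∈span hyperplane a → x ∈span hyperplane b → ¬ (a t ≈ b t) →
             (∀ l → l ≢ t → x (suc l) * a l ≈ x (suc l) * b l) → x (suc t) ≈ 0#
  separate a b t x x∈a x∈b aₜ≉bₜ agree =
    *-cancel-≉ (x (suc t)) (a t) (b t) aₜ≉bₜ (+-cancelʳ rest _ _ forms-agree)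
    where
      rest : Carrier
      rest = sum (λ r → x (suc (punchIn t r)) * a (punchIn t r))

      forms-agree : x (suc t) * a t + rest ≈ x (suc t) * b t + rest
      forms-agree = begin
        x (suc t) * a t + rest
          ≈⟨ sum-remove {i = t} (λ l → x (suc l) * a l) ⟨
        form a x
          ≈⟨ ∈hyperplane a x x∈a ⟨
        x zero
          ≈⟨ ∈hyperplane b x x∈b ⟩
        form b x
          ≈⟨ sum-remove {i = t} (λ l → x (suc l) * b l) ⟩
        x (suc t) * b t + sum (λ r → x (suc (punchIn t r)) * b (punchIn t r))
          ≈⟨ +-congˡ (sum-cong-≋ λ r → sym (agree (punchIn t r) (punchInᵢ≢i t r))) ⟩
        x (suc t) * b t + rest
          ∎

skip₂ : ∀ {p} {i j : Fin (suc (suc p))} → j ≢ i → Fin p → Fin (suc (suc p))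
skip₂ {j = j} j≢i m = punchIn j (punchIn (punchOut j≢i) m)

skip₂-cover : ∀ {p} {i j : Fin (suc (suc p))} (j≢i : j ≢ i) l → l ≢ i → l ≢ j →
              ∃ λ m → skip₂ j≢i m ≡ l
skip₂-cover {i = i} {j} j≢i l l≢i l≢j = punchOut i'≢l' , hit
  where
    open ≡.≡-Reasoning
    j≢l : j ≢ l
    j≢l = l≢j ∘ ≡.sym
    i' l' : Fin _
    i' = punchOut j≢i
    l' = punchOut j≢l
    i'≢l' : i' ≢ l'
    i'≢l' i'≡l' = l≢i (begin
      l               ≡⟨ punchIn-punchOut j≢l ⟨
      punchIn j l'    ≡⟨ ≡.cong (punchIn j) i'≡l' ⟨
      punchIn j i'    ≡⟨ punchIn-punchOut j≢i ⟩
      i               ∎)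
    hit : skip₂ j≢i (punchOut i'≢l') ≡ l
    hit = begin
      punchIn j (punchIn i' (punchOut i'≢l'))  ≡⟨ ≡.cong (punchIn j) (punchIn-punchOut i'≢l') ⟩
      punchIn j l'                             ≡⟨ punchIn-punchOut j≢l ⟩
      l                                        ∎

module FourHyperplanes {q : ℕ} {c ℓ : Level} (F : FiniteField q c ℓ) (p : ℕ) where
  open FiniteField F renaming (ring to R)
  open CommutativeRing R hiding (zero)
  open LinAlg R
  open Sums R
  open Hyperplanes R {suc (suc p)}
  open Elimination F using (dependence)
  open Separation F using (separate)

  -- p+1 vectors satisfy p linear conditions nontrivially: some nonzero
  -- combination of them vanishes at every tail coordinate except i+1, j+1.
  supported-combination : ∀ (T : Fin (suc p) → Vect (suc (suc (suc p)))) {i j} → j ≢ i →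
    Σ (Fin (suc p) → Carrier) λ co → (∃ λ r → ¬ (co r ≈ 0#)) ×
      (∀ l → l ≢ i → l ≢ j → lincomb T co (suc l) ≈ 0#)
  supported-combination T j≢i with dependence p (λ r m → T r (suc (skip₂ j≢i m)))
  ... | co , nontrivial , vanishes = co , nontrivial , λ l l≢i l≢j →
    let (m , m↦l) = skip₂-cover j≢i l l≢i l≢j
    in ≡.subst (λ l → lincomb T co (suc l) ≈ 0#) m↦l (vanishes m)

  -- The combination x
  -- above has x_{i+1} = 0 by the pair (aᵣ, aₛ), then x_{j+1} = 0 by (a₀, a₁),
  -- hence x = 0, contradicting the independence of T.
  no-four-hyperplanes : ∀ (T : Fin (suc p) → Vect (suc (suc (suc p)))) → LinIndep T →
    ∀ {i j} → i ≢ j → (a₀ a₁ aᵣ aₛ : Fin (suc (suc p)) → Carrier) →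
    ¬ (a₀ j ≈ a₁ j) → aᵣ j ≈ aₛ j → ¬ (aᵣ i ≈ aₛ i) →
    T ⊆span hyperplane a₀ → T ⊆span hyperplane a₁ → T ⊆span hyperplane aᵣ → T ⊆span hyperplane aₛ → ⊥
  no-four-hyperplanes T T-indep {i} {j} i≢j a₀ a₁ aᵣ aₛ a₀ⱼ≉a₁ⱼ aᵣⱼ≈aₛⱼ aᵣᵢ≉aₛᵢ T⊆a₀ T⊆a₁ T⊆aᵣ T⊆aₛ
    with supported-combination T (i≢j ∘ ≡.sym)
  ... | co , (r , coᵣ≉0) , off-support = coᵣ≉0 (T-indep co x≈0 r)
    where
      x : Vect (suc (suc (suc p)))
      x = lincomb T co

      x∈ : ∀ {a} → T ⊆span hyperplane a → x ∈span hyperplane a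
      x∈ T⊆a = T⊆a x (co , λ _ → refl)

      vanishing : ∀ {l} a b → x (suc l) ≈ 0# → x (suc l) * a ≈ x (suc l) * b
      vanishing a b xₗ≈0 = trans (*-congʳ xₗ≈0) (trans (zeroˡ a) (sym (trans (*-congʳ xₗ≈0) (zeroˡ b))))

      xᵢ≈0 : x (suc i) ≈ 0#
      xᵢ≈0 = separate aᵣ aₛ i x (x∈ T⊆aᵣ) (x∈ T⊆aₛ) aᵣᵢ≉aₛᵢ agree
        where
          agree : ∀ l → l ≢ i → x (suc l) * aᵣ l ≈ x (suc l) * aₛ l
          agree l l≢i with l ≟ᶠ j
          ... | yes ≡.refl = *-congˡ aᵣⱼ≈aₛⱼ
          ... | no  l≢j    = vanishing (aᵣ l) (aₛ l) (off-support l l≢i l≢j)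

      xⱼ≈0 : x (suc j) ≈ 0#
      xⱼ≈0 = separate a₀ a₁ j x (x∈ T⊆a₀) (x∈ T⊆a₁) a₀ⱼ≉a₁ⱼ agree
        where
          agree : ∀ l → l ≢ j → x (suc l) * a₀ l ≈ x (suc l) * a₁ l
          agree l l≢j with l ≟ᶠ i
          ... | yes ≡.refl = vanishing (a₀ l) (a₁ l) xᵢ≈0
          ... | no  l≢i    = vanishing (a₀ l) (a₁ l) (off-support l l≢i l≢j)

      x-tail≈0 : ∀ l → x (suc l) ≈ 0#
      x-tail≈0 l with l ≟ᶠ i | l ≟ᶠ j
      ... | yes ≡.refl | _          = xᵢ≈0
      ... | no _       | yes ≡.refl = xⱼ≈0
      ... | no l≢i     | no l≢j     = off-support l l≢i l≢j

      x≈0 : ∀ m → x m ≈ 0#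
      x≈0 zero    = trans (∈hyperplane a₀ x (x∈ T⊆a₀))
                          (sum-zero _ λ l → trans (*-congʳ (x-tail≈0 l)) (zeroˡ (a₀ l)))
      x≈0 (suc l) = x-tail≈0 l

-- The library's bijection Fin (m ^ n) ≅ (Fin n → Fin m) is injective up to
-- pointwise equality of functions (no function extensionality needed).
funToFin-cong : ∀ {m n} {f g : Fin m → Fin n} → f ≗ g → funToFin f ≡ funToFin g
funToFin-cong {zero}  f≗g = ≡.refl
funToFin-cong {suc m} f≗g = ≡.cong₂ combine (f≗g zero) (funToFin-cong (f≗g ∘ suc))

finToFun-injective : ∀ {m n} {x y : Fin (m ^ n)} → finToFun {m} {n} x ≗ finToFun {m} {n} y → x ≡ y
finToFun-injective {m} {n} {x} {y} x≗y = begin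
  x                               ≡⟨ funToFin-finToFin {n} {m} x ⟨
  funToFin (finToFun {m} {n} x)   ≡⟨ funToFin-cong {n} {m} x≗y ⟩
  funToFin (finToFun {m} {n} y)   ≡⟨ funToFin-finToFin {n} {m} y ⟩
  y                               ∎
  where open ≡.≡-Reasoning

module Construction {q : ℕ} {c ℓ : Level} (F : FiniteField q c ℓ) (p : ℕ) where
  open FiniteField F renaming (_≟_ to _≈?_; ring to R)
  open CommutativeRing R hiding (zero)
  open LinAlg R
  open Hyperplanes R {suc (suc p)}
  open FourHyperplanes F p using (no-four-hyperplanes)

  -- The x-th form a ∈ F^k, enumerating F^k through Fin (q^k) ≅ (Fin k → Fin q).
  form-of : Fin (q ^ suc (suc p)) → Fin (suc (suc p)) → Carrier
  form-of x i = enum (finToFun x i)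

  blocks : Fin (q ^ suc (suc p)) → Fin (suc (suc p)) → Vect (suc (suc (suc p)))
  blocks x = hyperplane (form-of x)

  form-of-injective : ∀ x y → (∀ i → form-of x i ≈ form-of y i) → x ≡ y
  form-of-injective x y x≈y = finToFun-injective (λ i → enum-inj _ _ (x≈y i))

  forms-differ : ∀ {x y} → x ≢ y → ∃ λ i → ¬ (form-of x i ≈ form-of y i)
  forms-differ {x} {y} x≢y = ¬∀⟶∃¬ _ _ (λ i → form-of x i ≈? form-of y i) (x≢y ∘ form-of-injective x y)

  blocks-distinct : ∀ x y → SameSpan (blocks x) (blocks y) → x ≡ y
  blocks-distinct x y (x⊆y , _) = form-of-injective x y (hyperplane-injective (form-of x) (form-of y) x⊆y)

  -- Take j where the forms of blocks 0 and
  -- 1 differ; by pigeonhole two of the q+1 forms, r and s, agree at j, and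
  -- they differ at some i ≠ j.
  blocks-packing : ∀ (T : Fin (suc p) → Vect (suc (suc (suc p)))) → LinIndep T →
    ∀ (g : Fin (suc q) → Fin (q ^ suc (suc p))) → (∀ a b → g a ≡ g b → a ≡ b) →
    ¬ (∀ a → T ⊆span blocks (g a))
  blocks-packing T T-indep g g-inj T⊆ =
    no-four-hyperplanes T T-indep i≢j (A zero) (A one) (A r) (A s) A₀ⱼ≉A₁ⱼ Aᵣⱼ≈Aₛⱼ Aᵣᵢ≉Aₛᵢ
      (T⊆ zero) (T⊆ one) (T⊆ r) (T⊆ s)
    where
      A : Fin (suc q) → Fin (suc (suc p)) → Carrier
      A a = form-of (g a)

      -- q ≥ 1 because the field has an element, so there is a second block
      one : Fin (suc q)
      one = suc (proj₁ (enum-sur 0#))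

      j₀₁ = forms-differ {g zero} {g one} (0≢1+n ∘ g-inj zero one)
      j = proj₁ j₀₁
      A₀ⱼ≉A₁ⱼ = proj₂ j₀₁

      collision = pigeonhole (n<1+n q) (λ a → finToFun (g a) j)
      r = proj₁ collision
      s = proj₁ (proj₂ collision)
      Aᵣⱼ≈Aₛⱼ : A r j ≈ A s j
      Aᵣⱼ≈Aₛⱼ = reflexive (≡.cong enum (proj₂ (proj₂ (proj₂ collision))))

      iᵣₛ = forms-differ {g r} {g s} (<⇒≢ (proj₁ (proj₂ (proj₂ collision))) ∘ g-inj r s)
      i = proj₁ iᵣₛ
      Aᵣᵢ≉Aₛᵢ = proj₂ iᵣₛ

      i≢j : i ≢ j
      i≢j i≡j = Aᵣᵢ≉Aₛᵢ (≡.subst (λ t → A r t ≈ A s t) (≡.sym i≡j) Aᵣⱼ≈Aₛⱼ)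

lemma3 : ∀ (q : ℕ) {c ℓ : Level} (F : FiniteField q c ℓ) (n : ℕ) → 3 ≤ n →
    ∃ λ (m : ℕ) → (q ^ (n ∸ 1) ≤ m) ×
    Σ (Fin m → Fin (n ∸ 1) → LinAlg.Vect (FiniteField.ring F) n)
    (λ blocks → LinAlg.IsPacking (FiniteField.ring F) n (n ∸ 1) (n ∸ 2) q m blocks)
lemma3 q F (suc (suc (suc p))) _ =
  q ^ suc (suc p) , ≤-refl , blocks ,
  record { indep    = λ x → hyperplane-indep (form-of x)
         ; distinct = blocks-distinct
         ; packing  = blocks-packing }
  where
    open Construction F p
    open Hyperplanes (FiniteField.ring F) {suc (suc p)} using (hyperplane-indep)
lemma3 q F 0                 ()
lemma3 q F 1                 (s≤s ())
lemma3 q F 2                 (s≤s (s≤s ()))
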